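{- Let $G$ be a virtual spatial graph and let $D$ be a diagram of $G$. Then (i) $\max\deg R(D)\le c(D)+\beta_1(S_A)$, and (ii) $\min\deg R(D)\ge -c(D)-\beta_1(S_B)$.
   Context: A diagram $D$ of a virtual spatial graph is a generic immersion of a finite graph in the plane whose double points are classical crossings (with over/under information) or virtual crossings; $c(D)$ is the number of classical crossings. At each classical crossing there are three resolutions: the A-resolution and the B-resolution (the two Kauffman smoothings) and the X-resolution (replacing the crossing by a 4-valent vertex). A state $S$ is a choice of resolution at every classical crossing, regarded as an abstract graph (virtual crossings are not vertices; a vertexless circle component counts as a vertex with a loop); $a(S),b(S)$ are its numbers of A- and B-resolutions. For a graph $X$, $\beta_0(X),\beta_1(X)$ are the number of components and the first Betti number. For a state $S$, $H(S)=\sum_{F\subseteq E(S)}(-1)^{\beta_0(S-F)}(-A-2-A^{ -1})^{\beta_1(S-F)}$, where $S-F$ is $S$ with the edges in $F$ deleted (vertices kept). The Yamada polynomial is $R(D)=\sum_S A^{a(S)-b(S)}H(S)\in\mathbb{Z}[A^{\pm1}]$. $S_A$ (resp. $S_B$) denotes the state with all A-resolutions (resp. all B-resolutions). $\max\deg$ and $\min\deg$ denote the largest and smallest exponent of $A$ with nonzero coefficient. -}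

module Defs where

open import Data.Bool using (Bool; true; false; _∧_; _∨_; not; if_then_else_)
open import Data.Nat using (ℕ; zero; suc; _∸_) renaming (_≡ᵇ_ to _==_)
open import Data.Bool.ListAction using (any)
import Data.Nat as N
open import Data.Fin using (Fin; toℕ)
import Data.Fin as F
open import Data.Integer as ℤ using (ℤ; +_; -_; 0ℤ; 1ℤ; -1ℤ)
open import Data.List using (List; []; _∷_; _++_; map; concatMap; foldr; upTo; allFin; length; filter)
open import Data.Product using (_×_; _,_)
open import Relation.Nullary using (does)
open import Relation.Binary.PropositionalEquality using (_≡_)

-- Laurent polynomials in A, as formal finite sums of monomials
-- (exponent , coefficient).  Coefficients are read off with `coeff`.

LPoly : Set
LPoly = List (ℤ × ℤ)

lconst : ℤ → LPoly
lconst c = (0ℤ , c) ∷ []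

monoA : ℤ → LPoly
monoA e = (e , 1ℤ) ∷ []

_⊕_ : LPoly → LPoly → LPoly
p ⊕ q = p ++ q

_⊗_ : LPoly → LPoly → LPoly
p ⊗ q = concatMap (λ { (e , a) → map (λ { (f , b) → (e ℤ.+ f , a ℤ.* b) }) q }) p

lsum : List LPoly → LPoly
lsum = foldr _⊕_ []

lpow : LPoly → ℕ → LPoly
lpow p zero    = lconst 1ℤ
lpow p (suc n) = p ⊗ lpow p n

coeff : LPoly → ℤ → ℤ
coeff [] k = 0ℤ
coeff ((e , c) ∷ p) k = (if does (e ℤ.≟ k) then c else 0ℤ) ℤ.+ coeff p k

σ : LPoly
σ = (+ 1 , -1ℤ) ∷ (0ℤ , - (+ 2)) ∷ (-1ℤ , -1ℤ) ∷ []

signPow : ℕ → ℤ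
signPow zero = 1ℤ
signPow (suc n) = - signPow n

-- Finite abstract (multi)graphs: nodes 0 … N-1, edges as a list of
-- unordered endpoint pairs (loops and multi-edges allowed).

record Graph : Set where
  constructor mkGraph
  field
    nodes : ℕ
    edges : List (ℕ × ℕ)
open Graph public

countB : {A : Set} → (A → Bool) → List A → ℕ
countB p [] = 0
countB p (x ∷ xs) = (if p x then 1 else 0) N.+ countB p xs

adj : List (ℕ × ℕ) → ℕ → ℕ → Bool
adj E u v = any (λ { (x , y) → ((x == u) ∧ (y == v)) ∨ ((x == v) ∧ (y == u)) }) E

reachK : ℕ → List (ℕ × ℕ) → ℕ → ℕ → ℕ → Bool
reachK N E zero    u v = u == v
reachK N E (suc k) u v = reachK N E k u v ∨ any (λ w → reachK N E k u w ∧ adj E w v) (upTo N)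

connected : Graph → ℕ → ℕ → Bool
connected G u v = reachK (nodes G) (edges G) (nodes G) u v

-- β₀ : number of connected components
--      (= number of nodes that are the least node of their component)
β₀ : Graph → ℕ
β₀ G = countB (λ v → not (any (λ u → connected G u v) (upTo v))) (upTo (nodes G))

β₁ : Graph → ℕ
β₁ G = (length (edges G) N.+ β₀ G) ∸ nodes G

subsets : {A : Set} → List A → List (List A)
subsets [] = [] ∷ []
subsets (x ∷ xs) = let r = subsets xs in r ++ map (x ∷_) r

-- H(S) = Σ_{F ⊆ E(S)} (-1)^{β₀(S-F)} σ^{β₁(S-F)} ; we sum over the set
-- K = E(S) \ F of kept edges, which ranges over all subsets of E(S).
H : Graph → LPoly
H G = lsum (map (λ K → let G' = mkGraph (nodes G) K in
                        lconst (signPow (β₀ G')) ⊗ lpow σ (β₁ G'))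
                (subsets (edges G)))

-- Ports 0,1,2,3 of a crossing are its
-- four half-arcs in counterclockwise order, with 0 and 2 forming the
-- over-strand (1 and 3 the under-strand).  Virtual crossings carry no
-- combinatorial information.  nO counts the vertexless circle components
-- that meet no classical crossing.

data End (nV nC : ℕ) : Set where
  vert : Fin nV → End nV nC
  port : Fin nC → Fin 4 → End nV nC

record Diagram : Set where
  field
    nV   : ℕ
    nC   : ℕ
    nO   : ℕ
    arcs : List (End nV nC × End nV nC)
open Diagram public

isPort : {nV nC : ℕ} → Fin nC → Fin 4 → End nV nC → Bool
isPort c i (vert _)    = false
isPort c i (port c' i') = does (c F.≟ c') ∧ does (i F.≟ i')

occurrences : {nV nC : ℕ} → Fin nC → Fin 4 → List (End nV nC × End nV nC) → ℕ
occurrences c i [] = 0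
occurrences c i ((x , y) ∷ as) =
  (if isPort c i x then 1 else 0) N.+ (if isPort c i y then 1 else 0) N.+ occurrences c i as

WellFormed : Diagram → Set
WellFormed D = ∀ (c : Fin (nC D)) (i : Fin 4) → occurrences c i (arcs D) ≡ 1

crossings : Diagram → ℕ
crossings D = nC D

data Res : Set where
  resA resB resX : Res

State : Diagram → Set
State D = Fin (nC D) → Res

consS : {n : ℕ} → Res → (Fin n → Res) → Fin (suc n) → Res
consS r s F.zero = r
consS r s (F.suc i) = s i

allStates : (n : ℕ) → List (Fin n → Res)
allStates zero = (λ ()) ∷ []
allStates (suc n) = concatMap (λ r → map (consS r) (allStates n)) (resA ∷ resB ∷ resX ∷ [])

countRes : {n : ℕ} → Res → (Fin n → Res) → ℕ
countRes r s = countB (λ i → does (eqRes r (s i))) (allFin _)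
  where
  open import Relation.Nullary using (Dec; yes; no)
  import Relation.Binary.PropositionalEquality as Eq
  eqRes : (x y : Res) → Dec (x Eq.≡ y)
  eqRes resA resA = yes Eq.refl
  eqRes resA resB = no (λ ())
  eqRes resA resX = no (λ ())
  eqRes resB resA = no (λ ())
  eqRes resB resB = yes Eq.refl
  eqRes resB resX = no (λ ())
  eqRes resX resA = no (λ ())
  eqRes resX resB = no (λ ())
  eqRes resX resX = yes Eq.refl

-- Node numbering of the state graph:
--   graph vertex v          ↦ v
--   port i of crossing c    ↦ nV + 4c + i
--   X-vertex of crossing c  ↦ nV + 4nC + c
--   free circle o           ↦ nV + 5nC + o
module _ (D : Diagram) where
  vnode : Fin (nV D) → ℕ
  vnode v = toℕ v
  pnode : Fin (nC D) → ℕ → ℕ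
  pnode c i = nV D N.+ 4 N.* toℕ c N.+ i
  cnode : Fin (nC D) → ℕ
  cnode c = nV D N.+ 4 N.* nC D N.+ toℕ c
  onode : ℕ → ℕ
  onode o = nV D N.+ 5 N.* nC D N.+ o

  endNode : End (nV D) (nC D) → ℕ
  endNode (vert v)   = vnode v
  endNode (port c i) = pnode c (toℕ i)

  -- Kauffman convention: the A-smoothing joins the two regions swept by
  -- the over-strand when rotated counterclockwise; with our port order
  -- this pairs ports {0,3} and {1,2}; the B-smoothing pairs {0,1},{2,3};
  -- the X-resolution makes the crossing a 4-valent vertex.
  resEdges : Res → Fin (nC D) → List (ℕ × ℕ)
  -- (In the A/B cases the node cnode c is used as a subdivision point of
  -- the first smoothing arc, so that it is never an isolated node.)
  resEdges resA c = (pnode c 0 , cnode c) ∷ (cnode c , pnode c 3) ∷ (pnode c 1 , pnode c 2) ∷ []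
  resEdges resB c = (pnode c 0 , cnode c) ∷ (cnode c , pnode c 1) ∷ (pnode c 2 , pnode c 3) ∷ []
  resEdges resX c = map (λ i → (cnode c , pnode c i)) (0 ∷ 1 ∷ 2 ∷ 3 ∷ [])

  -- A vertexless circle is a node with a loop.
  stateGraph : State D → Graph
  stateGraph s = mkGraph (nV D N.+ 5 N.* nC D N.+ nO D)
    (map (λ { (x , y) → (endNode x , endNode y) }) (arcs D)
     ++ concatMap (λ c → resEdges (s c) c) (allFin (nC D))
     ++ map (λ o → (onode o , onode o)) (upTo (nO D)))

  S_A : State D
  S_A _ = resA

  S_B : State D
  S_B _ = resB

  R : LPoly
  R = lsum (map (λ s → monoA (+ countRes resA s ℤ.- + countRes resB s) ⊗ H (stateGraph s))
                (allStates (nC D)))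

module Submission where

-- A state S contributes A^(a(S) - b(S)) H(S), and every exponent of H(S) lies in
-- [-β₁(S), β₁(S)] because deleting edges never increases β₁.  To compare S with S_A,
-- track φ = |E| + β₀ = β₁ + |V| while changing one crossing at a time: replacing a
-- B-smoothing by the A-smoothing exchanges two edges and lowers φ by at most 2, and
-- replacing the 4-valent vertex by the A-smoothing removes one edge but merges no
-- components, since the star already joins the ends of each smoothing arc.  Hence
-- β₁(S) ≤ β₁(S_A) + 2b(S) + x(S), i.e. a(S) - b(S) + β₁(S) ≤ c(D) + β₁(S_A).
-- The lower bound is the same argument run against S_B.

open import Defs
open import Data.Bool using (Bool; true; false; T; T?; not; _∧_; if_then_else_)
open import Data.Bool.Properties using (T-∧; T-∨)
open import Data.Bool.ListAction using (any)
open import Data.Empty using (⊥; ⊥-elim)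
open import Data.Integer as ℤ using (ℤ; +_; -_; 0ℤ; 1ℤ; -1ℤ; +≤+; -≤+)
import Data.Integer.Properties as ℤP
open import Data.Integer.Tactic.RingSolver using (solve-∀)
open import Data.Nat using (ℕ; zero; suc; _+_; _*_; _∸_; _≤_; _<_; z≤n; s≤s; _≤′_; ≤′-refl; ≤′-step) renaming (_≡ᵇ_ to _==_)
open import Data.Nat.Properties
open import Algebra.Properties.CommutativeSemigroup +-commutativeSemigroup using (interchange; x∙yz≈y∙xz; x∙yz≈yx∙z; xy∙z≈xz∙y)
open import Data.List using (List; []; _∷_; _++_; [_]; map; concatMap; upTo; allFin; length)
open import Data.Nat.ListAction using (sum)
open import Data.List.Properties using (length-upTo; length-tabulate; ++-assoc)
open import Data.List.Membership.Propositional using (_∈_; find; lose)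
open import Data.List.Membership.Propositional.Properties using (∈-upTo⁺; ∈-upTo⁻; ∈-++⁺ˡ; ∈-++⁺ʳ; ∈-++⁻; ∈-map⁻)
open import Data.List.Relation.Binary.Permutation.Propositional using (_↭_; ↭-sym)
open import Data.List.Relation.Binary.Permutation.Propositional.Properties using (↭-length; ∈-resp-↭; shift; shifts)
open import Data.List.Relation.Binary.Sublist.Propositional using (_⊆_; []; _∷_; _∷ʳ_)
open import Data.List.Relation.Unary.All using (All; []; _∷_)
import Data.List.Relation.Unary.All as All
import Data.List.Relation.Unary.All.Properties as All
open import Data.List.Relation.Unary.Any using (here; there)
open import Data.List.Relation.Unary.Any.Properties using (any⁺; any⁻)
open import Data.List.Relation.Unary.Unique.Propositional using (Unique; []; _∷_)
open import Data.List.Relation.Unary.Unique.Propositional.Properties using (upTo⁺)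
open import Data.Fin using (Fin; toℕ)
open import Data.Fin.Properties using (toℕ<n)
open import Data.Product using (Σ; ∃-syntax; _×_; _,_; proj₁; proj₂)
open import Data.Sum using (_⊎_; inj₁; inj₂)
open import Function using (_∘_; id)
open import Function.Bundles using (Equivalence)
open import Relation.Binary.Construct.Closure.ReflexiveTransitive using (Star; ε; _◅_; _◅◅_; reverse; _⋆)
open import Relation.Nullary using (¬_; yes; no)
open import Relation.Binary.PropositionalEquality using (_≡_; _≢_; refl; sym; trans; cong; cong₂; subst; subst₂; module ≡-Reasoning)

open Equivalence using (to; from)

module _ {A : Set} where

  countB-≤-length : (p : A → Bool) (xs : List A) → countB p xs ≤ length xs
  countB-≤-length p [] = z≤n
  countB-≤-length p (x ∷ xs) with p x
  ... | true  = s≤s (countB-≤-length p xs)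
  ... | false = m≤n⇒m≤1+n (countB-≤-length p xs)

  ∈⇒countB-pos : ∀ {p : A → Bool} {x} xs → x ∈ xs → T (p x) → 0 < countB p xs
  ∈⇒countB-pos {p} (y ∷ xs) (here refl) py with p y | py
  ... | true | _ = s≤s z≤n
  ∈⇒countB-pos (y ∷ xs) (there x∈xs) px = ≤-trans (∈⇒countB-pos xs x∈xs px) (m≤n+m _ _)

  countB-cong : ∀ {p q : A → Bool} xs → (∀ x → p x ≡ q x) → countB p xs ≡ countB q xs
  countB-cong         []       p≡q = refl
  countB-cong {p} {q} (x ∷ xs) p≡q = cong₂ (λ b m → (if b then 1 else 0) + m) (p≡q x) (countB-cong xs p≡q)

  countB-mono : ∀ {p q : A → Bool} xs → (∀ {x} → x ∈ xs → T (p x) → T (q x)) →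
                countB p xs ≤ countB q xs
  countB-mono [] p⇒q = z≤n
  countB-mono {p} {q} (x ∷ xs) p⇒q with p x in px | q x in qx
  ... | true  | true  = s≤s (countB-mono xs (p⇒q ∘ there))
  ... | false | true  = m≤n⇒m≤1+n (countB-mono xs (p⇒q ∘ there))
  ... | false | false = countB-mono xs (p⇒q ∘ there)
  ... | true  | false = ⊥-elim (subst T qx (p⇒q (here refl) (subst T (sym px) _)))

  countB-≡⇒converse : ∀ {p q : A → Bool} xs → (∀ {x} → x ∈ xs → T (p x) → T (q x)) →
                     countB p xs ≡ countB q xs → ∀ {x} → x ∈ xs → T (q x) → T (p x)
  countB-≡⇒converse {p} {q} (y ∷ xs) p⇒q eq x∈ qx with p y in py | q y in qy
  ... | true  | false = ⊥-elim (subst T qy (p⇒q (here refl) (subst T (sym py) _)))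
  ... | false | true  = ⊥-elim (<-irrefl eq (s≤s (countB-mono xs (p⇒q ∘ there))))
  countB-≡⇒converse (y ∷ xs) p⇒q eq (here refl) qx | true  | true  = subst T (sym py) _
  countB-≡⇒converse (y ∷ xs) p⇒q eq (here refl) qx | false | false = ⊥-elim (subst T qy qx)
  countB-≡⇒converse (y ∷ xs) p⇒q eq (there x∈) qx  | true  | true  =
    countB-≡⇒converse xs (p⇒q ∘ there) (suc-injective eq) x∈ qx
  countB-≡⇒converse (y ∷ xs) p⇒q eq (there x∈) qx  | false | false =
    countB-≡⇒converse xs (p⇒q ∘ there) eq x∈ qx

  countB-≤-suc : ∀ {p q : A → Bool} xs → Unique xs →
                 (∀ {y z} → y ∈ xs → z ∈ xs → T (p y) → ¬ T (q y) → T (p z) → ¬ T (q z) → y ≡ z) →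
                 countB p xs ≤ suc (countB q xs)
  countB-≤-suc [] _ _ = z≤n
  countB-≤-suc {p} {q} (x ∷ xs) (x∉xs ∷ uniq) atMostOne with p x in px | q x in qx
  ... | true  | true  = s≤s (countB-≤-suc xs uniq (λ y∈ z∈ → atMostOne (there y∈) (there z∈)))
  ... | false | true  = m≤n⇒m≤1+n (countB-≤-suc xs uniq (λ y∈ z∈ → atMostOne (there y∈) (there z∈)))
  ... | false | false = countB-≤-suc xs uniq (λ y∈ z∈ → atMostOne (there y∈) (there z∈))
  ... | true  | false = s≤s (countB-mono xs p⇒q)
    where
    p⇒q : ∀ {y} → y ∈ xs → T (p y) → T (q y)
    p⇒q {y} y∈ py with q y in qy
    ... | true  = _
    ... | false = ⊥-elim (All.lookup x∉xs y∈ (atMostOne (here refl) (there y∈)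
                    (subst T (sym px) _) (subst T qx) py (subst T qy)))

∈-subsets⇒⊆ : {A : Set} {K : List A} (xs : List A) → K ∈ subsets xs → K ⊆ xs
∈-subsets⇒⊆ []       (here refl) = []
∈-subsets⇒⊆ (x ∷ xs) K∈ with ∈-++⁻ (subsets xs) K∈
... | inj₁ K∈dropped = x ∷ʳ ∈-subsets⇒⊆ xs K∈dropped
... | inj₂ K∈kept with ∈-map⁻ (x ∷_) K∈kept
...   | K′ , K′∈ , refl = refl ∷ ∈-subsets⇒⊆ xs K′∈

ExponentsIn : ℤ → ℤ → LPoly → Set
ExponentsIn lo hi = All λ (e , _) → lo ℤ.≤ e × e ℤ.≤ hi

coeff≢0⇒∈ : ∀ {lo hi} p {k} → ExponentsIn lo hi p → coeff p k ≢ 0ℤ → lo ℤ.≤ k × k ℤ.≤ hi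
coeff≢0⇒∈ [] [] nonzero = ⊥-elim (nonzero refl)
coeff≢0⇒∈ ((e , c) ∷ p) {k} (e∈ ∷ p∈) nonzero with e ℤ.≟ k
... | yes refl = e∈
... | no  _    = coeff≢0⇒∈ p p∈ (nonzero ∘ trans (ℤP.+-identityˡ (coeff p k)))

ExponentsIn-weaken : ∀ {lo hi lo′ hi′} → lo ℤ.≤ lo′ → hi′ ℤ.≤ hi → ∀ {p} →
                     ExponentsIn lo′ hi′ p → ExponentsIn lo hi p
ExponentsIn-weaken lo≤ ≤hi = All.map λ (lo′≤e , e≤hi′) → ℤP.≤-trans lo≤ lo′≤e , ℤP.≤-trans e≤hi′ ≤hi

ExponentsIn-lsum : ∀ {A : Set} {lo hi} (f : A → LPoly) xs →
                   (∀ {x} → x ∈ xs → ExponentsIn lo hi (f x)) → ExponentsIn lo hi (lsum (map f xs))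
ExponentsIn-lsum f []       _  = []
ExponentsIn-lsum f (x ∷ xs) f∈ = All.++⁺ (f∈ (here refl)) (ExponentsIn-lsum f xs (f∈ ∘ there))

ExponentsIn-⊗ : ∀ {lo₁ hi₁ lo₂ hi₂} p q → ExponentsIn lo₁ hi₁ p → ExponentsIn lo₂ hi₂ q →
                ExponentsIn (lo₁ ℤ.+ lo₂) (hi₁ ℤ.+ hi₂) (p ⊗ q)
ExponentsIn-⊗ []            q []          q∈ = []
ExponentsIn-⊗ {lo₁} {hi₁} {lo₂} {hi₂} ((e , a) ∷ p) q (e∈ ∷ p∈) q∈ =
  All.++⁺ (shifted q q∈) (ExponentsIn-⊗ p q p∈ q∈)
  where
  shifted : ∀ q → ExponentsIn lo₂ hi₂ q →
            ExponentsIn (lo₁ ℤ.+ lo₂) (hi₁ ℤ.+ hi₂) (map (λ { (f , b) → (e ℤ.+ f , a ℤ.* b) }) q)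
  shifted []            []          = []
  shifted ((f , b) ∷ q) (f∈ ∷ q∈) =
    (ℤP.+-mono-≤ (proj₁ e∈) (proj₁ f∈) , ℤP.+-mono-≤ (proj₂ e∈) (proj₂ f∈)) ∷ shifted q q∈

ExponentsIn-lconst : ∀ c → ExponentsIn 0ℤ 0ℤ (lconst c)
ExponentsIn-lconst c = (ℤP.≤-refl , ℤP.≤-refl) ∷ []

ExponentsIn-σ^ : ∀ n → ExponentsIn (- + n) (+ n) (lpow σ n)
ExponentsIn-σ^ zero    = ExponentsIn-lconst 1ℤ
ExponentsIn-σ^ (suc n) =
  ExponentsIn-weaken (ℤP.≤-reflexive (ℤP.neg-distrib-+ (+ 1) (+ n))) ℤP.≤-refl
    (ExponentsIn-⊗ σ (lpow σ n) σ∈ (ExponentsIn-σ^ n))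
  where
  σ∈ : ExponentsIn -1ℤ (+ 1) σ
  σ∈ = (-≤+ , ℤP.≤-refl) ∷ (-≤+ , +≤+ z≤n) ∷ (ℤP.≤-refl , -≤+) ∷ []

T-not⇒¬T : ∀ {b} → T (not b) → ¬ T b
T-not⇒¬T {false} _ ()

¬T-not⇒T : ∀ {b} → ¬ T (not b) → T b
¬T-not⇒T {true}  _ = _
¬T-not⇒T {false} h = ⊥-elim (h _)

Edges : Set
Edges = List (ℕ × ℕ)

Link : Edges → ℕ → ℕ → Set
Link E u v = (u , v) ∈ E ⊎ (v , u) ∈ E

link-sym : ∀ {E u v} → Link E u v → Link E v u
link-sym (inj₁ uv) = inj₂ uv
link-sym (inj₂ vu) = inj₁ vu

pair-≡ᵇ⇒≡ : ∀ {x y u v} → T ((x == u) ∧ (y == v)) → (x , y) ≡ (u , v)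
pair-≡ᵇ⇒≡ {x} {y} {u} {v} h = let x≡u , y≡v = to T-∧ h in cong₂ _,_ (≡ᵇ⇒≡ x u x≡u) (≡ᵇ⇒≡ y v y≡v)

adj⁻ : ∀ E {u v} → T (adj E u v) → Link E u v
adj⁻ E h with find (any⁻ _ E h)
... | _ , xy∈E , matches with to T-∨ matches
...   | inj₁ xy≡uv = inj₁ (subst (_∈ E) (pair-≡ᵇ⇒≡ xy≡uv) xy∈E)
...   | inj₂ xy≡vu = inj₂ (subst (_∈ E) (pair-≡ᵇ⇒≡ xy≡vu) xy∈E)

adj⁺ : ∀ E {u v} → Link E u v → T (adj E u v)
adj⁺ E {u} {v} (inj₁ uv∈E) =
  any⁺ _ (lose uv∈E (from T-∨ (inj₁ (from T-∧ (≡⇒≡ᵇ u u refl , ≡⇒≡ᵇ v v refl)))))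
adj⁺ E {u} {v} (inj₂ vu∈E) =
  any⁺ _ (lose vu∈E (from T-∨ (inj₂ (from T-∧ (≡⇒≡ᵇ v v refl , ≡⇒≡ᵇ u u refl)))))

module Connectivity (N : ℕ) where

  data Step (E : Edges) (u v : ℕ) : Set where
    step : u < N → v < N → Link E u v → Step E u v

  Path : Edges → ℕ → ℕ → Set
  Path E = Star (Step E)

  path-sym : ∀ {E u v} → Path E u v → Path E v u
  path-sym = reverse λ { (step u<N v<N uv) → step v<N u<N (link-sym uv) }

  edge-path : ∀ {E u v} → (u , v) ∈ E → u < N → v < N → Path E u v
  edge-path uv∈E u<N v<N = step u<N v<N (inj₁ uv∈E) ◅ ε

  Connects : Edges → Edges → Set
  Connects E E′ = ∀ {u v} → Step E′ u v → Path E u v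

  connects-edges : ∀ {E E′} → (∀ {u v} → (u , v) ∈ E′ → u < N → v < N → Path E u v) → Connects E E′
  connects-edges paths (step u<N v<N (inj₁ uv∈E′)) = paths uv∈E′ u<N v<N
  connects-edges paths (step u<N v<N (inj₂ vu∈E′)) = path-sym (paths vu∈E′ v<N u<N)

  connects-⊇ : ∀ {E E′} → (∀ {e} → e ∈ E′ → e ∈ E) → Connects E E′
  connects-⊇ E′⊆E = connects-edges (edge-path ∘ E′⊆E)

  connects-++ : ∀ {E A B} → Connects E A → Connects E B → Connects E (A ++ B)
  connects-++ {A = A} cA cB (step u<N v<N (inj₁ uv)) with ∈-++⁻ A uv
  ... | inj₁ uv∈A = cA (step u<N v<N (inj₁ uv∈A))
  ... | inj₂ uv∈B = cB (step u<N v<N (inj₁ uv∈B))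
  connects-++ {A = A} cA cB (step u<N v<N (inj₂ vu)) with ∈-++⁻ A vu
  ... | inj₁ vu∈A = cA (step u<N v<N (inj₂ vu∈A))
  ... | inj₂ vu∈B = cB (step u<N v<N (inj₂ vu∈B))

  path-transport : ∀ {E E′} → Connects E E′ → ∀ {u v} → Path E′ u v → Path E u v
  path-transport connects = connects ⋆

  reachK-suc : ∀ E k {u v} → T (reachK N E k u v) → T (reachK N E (suc k) u v)
  reachK-suc E k r = from T-∨ (inj₁ r)

  reachK-step : ∀ E k {u w v} → T (reachK N E k u w) → Step E w v → T (reachK N E (suc k) u v)
  reachK-step E k r (step w<N _ wv) =
    from T-∨ (inj₂ (any⁺ _ (lose (∈-upTo⁺ w<N) (from T-∧ (r , adj⁺ E wv)))))

  reachK-mono : ∀ {E k l u v} → k ≤ l → T (reachK N E k u v) → T (reachK N E l u v)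
  reachK-mono k≤l = go (≤⇒≤′ k≤l)
    where
    go : ∀ {E k l u v} → k ≤′ l → T (reachK N E k u v) → T (reachK N E l u v)
    go               ≤′-refl         r = r
    go {E} {l = suc l} (≤′-step k≤′l) r = reachK-suc E l (go k≤′l r)

  reachK⇒path : ∀ E k {u v} → T (reachK N E k u v) → u < N → v < N → Path E u v
  reachK⇒path E zero {u} {v} r u<N v<N with ≡ᵇ⇒≡ u v r
  ... | refl = ε
  reachK⇒path E (suc k) r u<N v<N with to T-∨ r
  ... | inj₁ r′ = reachK⇒path E k r′ u<N v<N
  ... | inj₂ r′ with find (any⁻ _ (upTo N) r′)
  ...   | w , w∈ , rw∧wv with to T-∧ rw∧wv
  ...     | rw , wv = reachK⇒path E k rw u<N (∈-upTo⁻ w∈) ◅◅ step (∈-upTo⁻ w∈) v<N (adj⁻ E wv) ◅ ε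

  path⇒reachK : ∀ {E} k {u w v} → T (reachK N E k u w) → Path E w v → ∃[ l ] T (reachK N E l u v)
  path⇒reachK k r ε = k , r
  path⇒reachK {E} k r (s ◅ p) = path⇒reachK (suc k) (reachK-step E k r s) p

  -- The sets reached in k steps grow with k; once two consecutive ones agree the
  -- sequence is constant, and since they live in [0, N) this happens before k = N.
  module Saturation (E : Edges) {u : ℕ} (u<N : u < N) where

    reached : ℕ → ℕ
    reached k = countB (reachK N E k u) (upTo N)

    Settled : ℕ → Set
    Settled k = ∀ {v} → v < N → T (reachK N E (suc k) u v) → T (reachK N E k u v)

    settled-suc : ∀ {k} → Settled k → Settled (suc k)
    settled-suc settled v<N r with to T-∨ r
    ... | inj₁ r′ = r′
    ... | inj₂ r′ with find (any⁻ _ (upTo N) r′)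
    ...   | w , w∈ , rw∧wv with to T-∧ rw∧wv
    ...     | rw , wv = from T-∨ (inj₂ (any⁺ _ (lose w∈ (from T-∧ (settled (∈-upTo⁻ w∈) rw , wv)))))

    settled-+ : ∀ {k} → Settled k → ∀ m {v} → v < N → T (reachK N E (m + k) u v) → T (reachK N E k u v)
    settled-+ settled zero    v<N r = r
    settled-+ {k} settled (suc m) v<N r = settled-+ settled m v<N (iterate m v<N r)
      where
      iterate : ∀ m → Settled (m + k)
      iterate zero    = settled
      iterate (suc m) = settled-suc {m + k} (iterate m)

    reached-≤ : ∀ k → reached k ≤ N
    reached-≤ k = subst (reached k ≤_) (length-upTo N) (countB-≤-length _ (upTo N))

    reached-mono : ∀ k → reached k ≤ reached (suc k)
    reached-mono k = countB-mono (upTo N) (λ _ → reachK-suc E k)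

    reached-0 : 1 ≤ reached 0
    reached-0 = ∈⇒countB-pos (upTo N) (∈-upTo⁺ u<N) (≡⇒≡ᵇ u u refl)

    settled-or-grows : ∀ j → (∃[ k ] k < j × Settled k) ⊎ suc j ≤ reached j
    settled-or-grows zero = inj₂ reached-0
    settled-or-grows (suc j) with settled-or-grows j
    ... | inj₁ (k , k<j , settled) = inj₁ (k , m<n⇒m<1+n k<j , settled)
    ... | inj₂ grown with reached j ≟ reached (suc j)
    ...   | yes same = inj₁ (j , n<1+n j , λ v<N →
              countB-≡⇒converse (upTo N) (λ _ → reachK-suc E j) same (∈-upTo⁺ v<N))
    ...   | no  grew = inj₂ (≤-trans (s≤s grown) (≤∧≢⇒< (reached-mono j) grew))

    settles : ∃[ k ] k < N × Settled k
    settles with settled-or-grows N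
    ... | inj₁ found    = found
    ... | inj₂ overflow = ⊥-elim (<-irrefl refl (≤-trans overflow (reached-≤ N)))

    saturate : ∀ l {v} → v < N → T (reachK N E l u v) → T (reachK N E N u v)
    saturate l v<N r with settles | l ≤? N
    ... | _ | yes l≤N = reachK-mono l≤N r
    ... | k , k<N , settled | no l≰N =
      reachK-mono (<⇒≤ k<N) (settled-+ settled (l ∸ k) v<N (subst (λ m → T (reachK N E m u _)) l≡ r))
      where
      l≡ : l ≡ l ∸ k + k
      l≡ = sym (m∸n+n≡m (≤-trans (<⇒≤ k<N) (<⇒≤ (≰⇒> l≰N))))

  path⇒connected : ∀ {E u v} → u < N → v < N → Path E u v → T (connected (mkGraph N E) u v)
  path⇒connected {E} {u} u<N v<N p =
    let l , r = path⇒reachK 0 (≡⇒≡ᵇ u u refl) p in Saturation.saturate E u<N l v<N r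

  leader : Edges → ℕ → Bool
  leader E v = not (any (λ u → connected (mkGraph N E) u v) (upTo v))

  leader-minimal : ∀ {E u v} → T (leader E v) → v < N → Path E u v → v ≤ u
  leader-minimal {u = u} {v} isLeader v<N p with u <? v
  ... | no  u≮v = ≮⇒≥ u≮v
  ... | yes u<v = ⊥-elim (T-not⇒¬T isLeader
                    (any⁺ _ (lose (∈-upTo⁺ u<v) (path⇒connected (<-trans u<v v<N) v<N p))))

  leaders-unique : ∀ {E y z} → T (leader E y) → T (leader E z) → y < N → z < N → Path E y z → y ≡ z
  leaders-unique ly lz y<N z<N p = ≤-antisym (leader-minimal ly y<N (path-sym p)) (leader-minimal lz z<N p)

  non-leader⇒path : ∀ {E v} → ¬ T (leader E v) → v < N → ∃[ u ] u < v × Path E u v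
  non-leader⇒path {E} {v} notLeader v<N with find (any⁻ _ (upTo v) (¬T-not⇒T notLeader))
  ... | u , u∈ , c = u , ∈-upTo⁻ u∈ , reachK⇒path E N c (<-trans (∈-upTo⁻ u∈) v<N) v<N

  leader-antitone : ∀ {E E′ v} → Connects E E′ → v < N → T (leader E v) → T (leader E′ v)
  leader-antitone {E′ = E′} {v} connects v<N isLeader with T? (leader E′ v)
  ... | yes isLeader′ = isLeader′
  ... | no  notLeader′ with non-leader⇒path notLeader′ v<N
  ...   | u , u<v , p = ⊥-elim (<⇒≱ u<v (leader-minimal isLeader v<N (path-transport connects p)))

  components : Edges → ℕ
  components E = β₀ (mkGraph N E)

  components-antitone : ∀ {E E′} → Connects E E′ → components E ≤ components E′
  components-antitone connects =
    countB-mono (upTo N) (λ v∈ → leader-antitone connects (∈-upTo⁻ v∈))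

  link-∷⁻ : ∀ {a b E x w} → Link ((a , b) ∷ E) x w → (x ≡ a × w ≡ b) ⊎ (x ≡ b × w ≡ a) ⊎ Link E x w
  link-∷⁻ (inj₁ (here refl))  = inj₁ (refl , refl)
  link-∷⁻ (inj₂ (here refl))  = inj₂ (inj₁ (refl , refl))
  link-∷⁻ (inj₁ (there xw∈E)) = inj₂ (inj₂ (inj₁ xw∈E))
  link-∷⁻ (inj₂ (there wx∈E)) = inj₂ (inj₂ (inj₂ wx∈E))

  path-∷⁻ : ∀ {a b E x y} → Path ((a , b) ∷ E) x y →
            Path E x y ⊎ (Path E x a × Path E b y) ⊎ (Path E x b × Path E a y)
  path-∷⁻ ε = inj₁ ε
  path-∷⁻ (step x<N w<N xw ◅ p) with link-∷⁻ xw | path-∷⁻ p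
  ... | inj₂ (inj₂ xw′) | inj₁ q                 = inj₁ (step x<N w<N xw′ ◅ q)
  ... | inj₂ (inj₂ xw′) | inj₂ (inj₁ (q₁ , q₂)) = inj₂ (inj₁ (step x<N w<N xw′ ◅ q₁ , q₂))
  ... | inj₂ (inj₂ xw′) | inj₂ (inj₂ (q₁ , q₂)) = inj₂ (inj₂ (step x<N w<N xw′ ◅ q₁ , q₂))
  ... | inj₁ (refl , refl)        | inj₁ q                = inj₂ (inj₁ (ε , q))
  ... | inj₁ (refl , refl)        | inj₂ (inj₁ (_ , q))  = inj₂ (inj₁ (ε , q))
  ... | inj₁ (refl , refl)        | inj₂ (inj₂ (_ , q))  = inj₁ q
  ... | inj₂ (inj₁ (refl , refl)) | inj₁ q                = inj₂ (inj₂ (ε , q))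
  ... | inj₂ (inj₁ (refl , refl)) | inj₂ (inj₁ (_ , q))  = inj₁ q
  ... | inj₂ (inj₁ (refl , refl)) | inj₂ (inj₂ (_ , q))  = inj₂ (inj₂ (ε , q))

  ¬crossed-leaders : ∀ {E y z xy xz} → T (leader E y) → T (leader E z) → y < N → z < N →
            xy < y → Path E xy z → xz < z → Path E xz y → ⊥
  ¬crossed-leaders ly lz y<N z<N xy<y xy~z xz<z xz~y =
    <-asym (≤-<-trans (leader-minimal ly y<N xz~y) xz<z) (≤-<-trans (leader-minimal lz z<N xy~z) xy<y)

  module _ (E : Edges) (a b : ℕ) where

    lost-leader : ∀ {y} → T (leader E y) → ¬ T (leader ((a , b) ∷ E) y) → y < N →
                  ∃[ x ] x < y × ((Path E x a × Path E b y) ⊎ (Path E x b × Path E a y))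
    lost-leader isLeader notLeader y<N with non-leader⇒path notLeader y<N
    ... | x , x<y , p with path-∷⁻ p
    ...   | inj₁ q      = ⊥-elim (<⇒≱ x<y (leader-minimal isLeader y<N q))
    ...   | inj₂ joined = x , x<y , joined

    at-most-one-lost : ∀ {y z} → y ∈ upTo N → z ∈ upTo N →
                       T (leader E y) → ¬ T (leader ((a , b) ∷ E) y) →
                       T (leader E z) → ¬ T (leader ((a , b) ∷ E) z) → y ≡ z
    at-most-one-lost y∈ z∈ ly nly lz nlz
      with lost-leader ly nly (∈-upTo⁻ y∈) | lost-leader lz nlz (∈-upTo⁻ z∈)
    ... | _ , _ , inj₁ (_ , by) | _ , _ , inj₁ (_ , bz) =
      leaders-unique ly lz (∈-upTo⁻ y∈) (∈-upTo⁻ z∈) (path-sym by ◅◅ bz)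
    ... | _ , _ , inj₂ (_ , ay) | _ , _ , inj₂ (_ , az) =
      leaders-unique ly lz (∈-upTo⁻ y∈) (∈-upTo⁻ z∈) (path-sym ay ◅◅ az)
    ... | _ , xy<y , inj₁ (xa , by) | _ , xz<z , inj₂ (xb , az) =
      ⊥-elim (¬crossed-leaders ly lz (∈-upTo⁻ y∈) (∈-upTo⁻ z∈) xy<y (xa ◅◅ az) xz<z (xb ◅◅ by))
    ... | _ , xy<y , inj₂ (xb , ay) | _ , xz<z , inj₁ (xa , bz) =
      ⊥-elim (¬crossed-leaders ly lz (∈-upTo⁻ y∈) (∈-upTo⁻ z∈) xy<y (xb ◅◅ bz) xz<z (xa ◅◅ ay))

    components-∷ : components E ≤ suc (components ((a , b) ∷ E))
    components-∷ = countB-≤-suc (upTo N) (upTo⁺ N) at-most-one-lost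

  -- φ = β₁ + |V|; working with φ avoids truncated subtraction.
  φ : Edges → ℕ
  φ E = length E + components E

  φ-resp-↭ : ∀ {E E′} → E ↭ E′ → φ E ≡ φ E′
  φ-resp-↭ E↭E′ = cong₂ _+_ (↭-length E↭E′)
    (≤-antisym (components-antitone (connects-⊇ (∈-resp-↭ (↭-sym E↭E′))))
               (components-antitone (connects-⊇ (∈-resp-↭ E↭E′))))

  φ-∷ : ∀ e E → φ E ≤ φ (e ∷ E)
  φ-∷ (a , b) E = begin
    length E + components E                  ≤⟨ +-monoʳ-≤ (length E) (components-∷ E a b) ⟩
    length E + suc (components ((a , b) ∷ E)) ≡⟨ +-suc (length E) _ ⟩
    φ ((a , b) ∷ E)                          ∎
    where open ≤-Reasoning

  φ-∷-≤ : ∀ e E → φ (e ∷ E) ≤ suc (φ E)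
  φ-∷-≤ e E = s≤s (+-monoʳ-≤ (length E) (components-antitone (connects-⊇ there)))

  φ-++ˡ : ∀ L E → φ E ≤ φ (L ++ E)
  φ-++ˡ []      E = ≤-refl
  φ-++ˡ (e ∷ L) E = ≤-trans (φ-++ˡ L E) (φ-∷ e (L ++ E))

  φ-++-≤ : ∀ L E → φ (L ++ E) ≤ length L + φ E
  φ-++-≤ []      E = ≤-refl
  φ-++-≤ (e ∷ L) E = ≤-trans (φ-∷-≤ e (L ++ E)) (s≤s (φ-++-≤ L E))

  φ-exchange : ∀ L₁ L₂ E → φ (L₁ ++ E) ≤ length L₁ + φ (L₂ ++ E)
  φ-exchange L₁ L₂ E = begin
    φ (L₁ ++ E)         ≤⟨ φ-++ˡ L₂ (L₁ ++ E) ⟩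
    φ (L₂ ++ L₁ ++ E)   ≡⟨ φ-resp-↭ (shifts L₂ L₁) ⟩
    φ (L₁ ++ L₂ ++ E)   ≤⟨ φ-++-≤ L₁ (L₂ ++ E) ⟩
    length L₁ + φ (L₂ ++ E) ∎
    where open ≤-Reasoning

  φ-connects : ∀ {E E′} d → length E ≤ d + length E′ → Connects E E′ → φ E ≤ d + φ E′
  φ-connects {E} {E′} d short connects = begin
    length E + components E        ≤⟨ +-mono-≤ short (components-antitone connects) ⟩
    (d + length E′) + components E′ ≡⟨ +-assoc d (length E′) _ ⟩
    d + φ E′                        ∎
    where open ≤-Reasoning

  φ-++-mono-⊆ : ∀ P {K E} → K ⊆ E → φ (P ++ K) ≤ φ (P ++ E)
  φ-++-mono-⊆ P []               = ≤-refl
  φ-++-mono-⊆ P (_∷ʳ_ {ys = E} x K⊆E) = begin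
    φ (P ++ _)         ≤⟨ φ-++-mono-⊆ P K⊆E ⟩
    φ (P ++ E)         ≤⟨ φ-∷ x (P ++ E) ⟩
    φ (x ∷ P ++ E)     ≡⟨ φ-resp-↭ (↭-sym (shift x P E)) ⟩
    φ (P ++ x ∷ E)     ∎
    where open ≤-Reasoning
  φ-++-mono-⊆ P (_∷_ {x = x} {xs = K} {ys = E} refl K⊆E) =
    subst₂ (λ L L′ → φ L ≤ φ L′) (++-assoc P [ x ] K) (++-assoc P [ x ] E) (φ-++-mono-⊆ (P ++ [ x ]) K⊆E)

  β₁-mono-⊆ : ∀ {K E} → K ⊆ E → β₁ (mkGraph N K) ≤ β₁ (mkGraph N E)
  β₁-mono-⊆ K⊆E = ∸-monoˡ-≤ N (φ-++-mono-⊆ [] K⊆E)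

  φ-exchange-∷ : ∀ e L₁ L₂ E → φ (e ∷ L₁ ++ E) ≤ length L₁ + φ (e ∷ L₂ ++ E)
  φ-exchange-∷ e L₁ L₂ E = begin
    φ (e ∷ L₁ ++ E)           ≡⟨ φ-resp-↭ (↭-sym (shift e L₁ E)) ⟩
    φ (L₁ ++ e ∷ E)           ≤⟨ φ-exchange L₁ L₂ (e ∷ E) ⟩
    length L₁ + φ (L₂ ++ e ∷ E) ≡⟨ cong (λ m → length L₁ + m) (φ-resp-↭ (shift e L₂ E)) ⟩
    length L₁ + φ (e ∷ L₂ ++ E) ∎
    where open ≤-Reasoning

ExponentsIn-H : ∀ G → ExponentsIn (- + β₁ G) (+ β₁ G) (H G)
ExponentsIn-H (mkGraph N E) = ExponentsIn-lsum _ (subsets E) λ {K} K∈ →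
  let Gₖ = mkGraph N K
      β≤ = +≤+ (Connectivity.β₁-mono-⊆ N (∈-subsets⇒⊆ E K∈)) in
  ExponentsIn-weaken (ℤP.≤-trans (ℤP.neg-mono-≤ β≤) (ℤP.≤-reflexive (sym (ℤP.+-identityˡ _))))
                     (ℤP.≤-trans (ℤP.≤-reflexive (ℤP.+-identityˡ _)) β≤)
    (ExponentsIn-⊗ (lconst (signPow (β₀ Gₖ))) (lpow σ (β₁ Gₖ))
                   (ExponentsIn-lconst _) (ExponentsIn-σ^ (β₁ Gₖ)))

m≤w+n⇒m∸o≤w+[n∸o] : ∀ {m n} w o → m ≤ w + n → m ∸ o ≤ w + (n ∸ o)
m≤w+n⇒m∸o≤w+[n∸o] {m} {n} w o m≤w+n = ≤-trans (∸-monoˡ-≤ o m≤w+n) (m≤n+o⇒m∸n≤o (w + n) o (begin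
  w + n             ≤⟨ +-monoʳ-≤ w (m≤n+m∸n n o) ⟩
  w + (o + (n ∸ o)) ≡⟨ x∙yz≈y∙xz w o (n ∸ o) ⟩
  o + (w + (n ∸ o)) ∎))
  where open ≤-Reasoning

indicator : Bool → ℕ
indicator b = if b then 1 else 0

sum+countB : ∀ {A : Set} (w : A → ℕ) (p q : A → Bool) xs →
             (∀ x → w x + indicator (p x) ≡ suc (indicator (q x))) →
             sum (map w xs) + countB p xs ≡ length xs + countB q xs
sum+countB w p q []       _     = refl
sum+countB w p q (x ∷ xs) local = begin
  (w x + sum (map w xs)) + (indicator (p x) + countB p xs) ≡⟨ interchange (w x) _ _ _ ⟩
  (w x + indicator (p x)) + (sum (map w xs) + countB p xs) ≡⟨ cong₂ _+_ (local x) (sum+countB w p q xs local) ⟩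
  suc (indicator (q x)) + (length xs + countB q xs)
    ≡⟨ cong suc (x∙yz≈y∙xz (indicator (q x)) (length xs) (countB q xs)) ⟩
  suc (length xs) + (indicator (q x) + countB q xs)       ∎
  where open ≡-Reasoning

[a-b]+β≤C : ∀ a b β C → a + β ≤ C + b → (+ a ℤ.- + b) ℤ.+ + β ℤ.≤ + C
[a-b]+β≤C a b β C a+β≤C+b = begin
  (+ a ℤ.- + b) ℤ.+ + β  ≡⟨ rearrange (+ a) (+ b) (+ β) ⟩
  (+ a ℤ.+ + β) ℤ.- + b  ≤⟨ ℤP.+-monoˡ-≤ (- + b) (+≤+ a+β≤C+b) ⟩
  (+ C ℤ.+ + b) ℤ.- + b  ≡⟨ cancel (+ C) (+ b) ⟩
  + C                    ∎
  where
  open ℤP.≤-Reasoning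
  rearrange : ∀ x y z → (x ℤ.- y) ℤ.+ z ≡ (x ℤ.+ z) ℤ.- y
  rearrange = solve-∀
  cancel : ∀ x y → (x ℤ.+ y) ℤ.- y ≡ x
  cancel = solve-∀

-C≤[a-b]-β : ∀ a b β C → b + β ≤ C + a → - + C ℤ.≤ (+ a ℤ.- + b) ℤ.+ - + β
-C≤[a-b]-β a b β C b+β≤C+a = ℤP.≤-trans (ℤP.neg-mono-≤ ([a-b]+β≤C b a β C b+β≤C+a))
                                   (ℤP.≤-reflexive (negate (+ a) (+ b) (+ β)))
  where
  negate : ∀ x y z → - ((y ℤ.- x) ℤ.+ z) ≡ (x ℤ.- y) ℤ.+ - z
  negate = solve-∀

data Smoothing : Set where
  smoothA smoothB : Smoothing

resolution : Smoothing → Res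
resolution smoothA = resA
resolution smoothB = resB

opposite : Smoothing → Smoothing
opposite smoothA = smoothB
opposite smoothB = smoothA

-- A bound on how much φ can drop when the resolution r of a crossing is replaced by t.
cost : Smoothing → Res → ℕ
cost smoothA resA = 0
cost smoothB resB = 0
cost _       resX = 1
cost smoothA resB = 2
cost smoothB resA = 2

isRes : Res → Res → Bool
isRes resA resA = true
isRes resB resB = true
isRes resX resX = true
isRes _    _    = false

cost+indicator : ∀ t r → cost t r + indicator (isRes (resolution t) r)
                         ≡ suc (indicator (isRes (resolution (opposite t)) r))
cost+indicator smoothA resA = refl
cost+indicator smoothA resB = refl
cost+indicator smoothA resX = refl
cost+indicator smoothB resA = refl
cost+indicator smoothB resB = refl
cost+indicator smoothB resX = refl

-- countRes compares resolutions with a decision procedure that is local to Defs,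
-- so the predicate it counts can only be named by unification.
countedPredicate : ∀ {n} r (s : Fin n → Res) → Σ (Fin n → Bool) λ p → countRes r s ≡ countB p (allFin n)
countedPredicate r s = _ , refl

counted≡isRes : ∀ {n} r (s : Fin n → Res) i → proj₁ (countedPredicate r s) i ≡ isRes r (s i)
counted≡isRes resA s i with s i
... | resA = refl
... | resB = refl
... | resX = refl
counted≡isRes resB s i with s i
... | resA = refl
... | resB = refl
... | resX = refl
counted≡isRes resX s i with s i
... | resA = refl
... | resB = refl
... | resX = refl

countRes≡countB-isRes : ∀ {n} r (s : Fin n → Res) → countRes r s ≡ countB (λ i → isRes r (s i)) (allFin n)
countRes≡countB-isRes {n} r s = countB-cong (allFin n) (counted≡isRes r s)

totalCost : ∀ {n} → Smoothing → (Fin n → Res) → ℕ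
totalCost {n} t s = sum (map (cost t ∘ s) (allFin n))

totalCost+count : ∀ {n} t (s : Fin n → Res) →
                  totalCost t s + countRes (resolution t) s ≡ n + countRes (resolution (opposite t)) s
totalCost+count {n} t s = begin
  totalCost t s + countRes (resolution t) s
    ≡⟨ cong (λ m → totalCost t s + m) (countRes≡countB-isRes (resolution t) s) ⟩
  totalCost t s + countB (λ i → isRes (resolution t) (s i)) (allFin n)
    ≡⟨ sum+countB (cost t ∘ s) _ _ (allFin n) (λ i → cost+indicator t (s i)) ⟩
  length (allFin n) + countB (λ i → isRes (resolution (opposite t)) (s i)) (allFin n)
    ≡⟨ cong₂ _+_ (length-tabulate id) (sym (countRes≡countB-isRes (resolution (opposite t)) s)) ⟩
  n + countRes (resolution (opposite t)) s ∎
  where open ≡-Reasoning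

module Resolutions (D : Diagram) where

  order : ℕ
  order = nV D + 5 * nC D + nO D

  open Connectivity order

  cnode<order : ∀ c → cnode D c < order
  cnode<order c = begin-strict
    nV D + 4 * nC D + toℕ c <⟨ +-monoʳ-< (nV D + 4 * nC D) (toℕ<n c) ⟩
    nV D + 4 * nC D + nC D  ≡⟨ trans (+-assoc (nV D) _ _) (cong (λ m → nV D + m) (+-comm (4 * nC D) (nC D))) ⟩
    nV D + 5 * nC D         ≤⟨ m≤m+n _ (nO D) ⟩
    order                   ∎
    where open ≤-Reasoning

  star-connects : ∀ t c E → Connects (resEdges D resX c ++ E) (resEdges D (resolution t) c)
  star-connects t c E = connects-edges (arm t)
    where
    X = resEdges D resX c
    spoke : ∀ {p} → (cnode D c , p) ∈ X → p < order → Path (X ++ E) (cnode D c) p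
    spoke cp∈X p<N = edge-path (∈-++⁺ˡ cp∈X) (cnode<order c) p<N
    across : ∀ {p q} → (cnode D c , p) ∈ X → (cnode D c , q) ∈ X → p < order → q < order → Path (X ++ E) p q
    across cp∈X cq∈X p<N q<N = path-sym (spoke cp∈X p<N) ◅◅ spoke cq∈X q<N
    arm : ∀ t {u v} → (u , v) ∈ resEdges D (resolution t) c → u < order → v < order → Path (X ++ E) u v
    arm smoothA (here refl)                 p₀<N _    = path-sym (spoke (here refl) p₀<N)
    arm smoothA (there (here refl))         _    p₃<N = spoke (there (there (there (here refl)))) p₃<N
    arm smoothA (there (there (here refl))) p₁<N p₂<N =
      across (there (here refl)) (there (there (here refl))) p₁<N p₂<N
    arm smoothB (here refl)                 p₀<N _    = path-sym (spoke (here refl) p₀<N)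
    arm smoothB (there (here refl))         _    p₁<N = spoke (there (here refl)) p₁<N
    arm smoothB (there (there (here refl))) p₂<N p₃<N =
      across (there (there (here refl))) (there (there (there (here refl)))) p₂<N p₃<N

  length-star : ∀ t c E → length (resEdges D resX c ++ E) ≡ 1 + length (resEdges D (resolution t) c ++ E)
  length-star smoothA c E = refl
  length-star smoothB c E = refl

  φ-contract-star : ∀ t c E → φ (resEdges D resX c ++ E) ≤ 1 + φ (resEdges D (resolution t) c ++ E)
  φ-contract-star t c E = φ-connects 1 (≤-reflexive (length-star t c E))
    (connects-++ (star-connects t c E) (connects-⊇ (∈-++⁺ʳ _)))

  φ-resolve : ∀ t r c E → φ (resEdges D r c ++ E) ≤ cost t r + φ (resEdges D (resolution t) c ++ E)
  φ-resolve smoothA resA c E = ≤-refl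
  φ-resolve smoothB resB c E = ≤-refl
  φ-resolve smoothA resB c E = φ-exchange-∷ _ _ _ E
  φ-resolve smoothB resA c E = φ-exchange-∷ _ _ _ E
  φ-resolve smoothA resX c E = φ-contract-star smoothA c E
  φ-resolve smoothB resX c E = φ-contract-star smoothB c E

  resolved : State D → List (Fin (nC D)) → Edges
  resolved s = concatMap (λ c → resEdges D (s c) c)

  φ-resolved : ∀ t s cs E →
               φ (resolved s cs ++ E) ≤ sum (map (cost t ∘ s) cs) + φ (resolved (λ _ → resolution t) cs ++ E)
  φ-resolved t s []       E = ≤-refl
  φ-resolved t s (c ∷ cs) E = begin
    φ ((Rₛ ++ Rsₛ) ++ E)          ≡⟨ cong φ (++-assoc Rₛ Rsₛ E) ⟩
    φ (Rₛ ++ Rsₛ ++ E)            ≤⟨ φ-resolve t (s c) c (Rsₛ ++ E) ⟩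
    w + φ (Rₜ ++ Rsₛ ++ E)        ≡⟨ cong (λ m → w + m) (φ-resp-↭ (shifts Rₜ Rsₛ)) ⟩
    w + φ (Rsₛ ++ Rₜ ++ E)        ≤⟨ +-monoʳ-≤ w (φ-resolved t s cs (Rₜ ++ E)) ⟩
    w + (W + φ (Rsₜ ++ Rₜ ++ E))  ≡⟨ cong (λ m → w + (W + m)) (φ-resp-↭ (shifts Rsₜ Rₜ)) ⟩
    w + (W + φ (Rₜ ++ Rsₜ ++ E))  ≡⟨ sym (+-assoc w W _) ⟩
    (w + W) + φ (Rₜ ++ Rsₜ ++ E)  ≡⟨ cong (λ L → (w + W) + φ L) (sym (++-assoc Rₜ Rsₜ E)) ⟩
    (w + W) + φ ((Rₜ ++ Rsₜ) ++ E) ∎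
    where
    open ≤-Reasoning
    Rₛ = resEdges D (s c) c
    Rₜ = resEdges D (resolution t) c
    Rsₛ = resolved s cs
    Rsₜ = resolved (λ _ → resolution t) cs
    w = cost t (s c)
    W = sum (map (cost t ∘ s) cs)

  φ-resolved-between : ∀ t s P Q →
    φ (P ++ resolved s (allFin (nC D)) ++ Q)
    ≤ totalCost t s + φ (P ++ resolved (λ _ → resolution t) (allFin (nC D)) ++ Q)
  φ-resolved-between t s P Q = begin
    φ (P ++ Rₛ ++ Q)               ≡⟨ φ-resp-↭ (shifts P Rₛ) ⟩
    φ (Rₛ ++ P ++ Q)               ≤⟨ φ-resolved t s (allFin (nC D)) (P ++ Q) ⟩
    totalCost t s + φ (Rₜ ++ P ++ Q) ≡⟨ cong (λ m → totalCost t s + m) (φ-resp-↭ (shifts Rₜ P)) ⟩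
    totalCost t s + φ (P ++ Rₜ ++ Q) ∎
    where
    open ≤-Reasoning
    Rₛ = resolved s (allFin (nC D))
    Rₜ = resolved (λ _ → resolution t) (allFin (nC D))

  β₁-state-≤ : ∀ t s → β₁ (stateGraph D s) ≤ totalCost t s + β₁ (stateGraph D (λ _ → resolution t))
  β₁-state-≤ t s = m≤w+n⇒m∸o≤w+[n∸o] (totalCost t s) order (φ-resolved-between t s arcEdges circleEdges)
    where
    arcEdges circleEdges : Edges
    arcEdges = map (λ (x , y) → endNode D x , endNode D y) (arcs D)
    circleEdges = map (λ o → onode D o , onode D o) (upTo (nO D))

  count+β₁-≤ : ∀ t s → countRes (resolution t) s + β₁ (stateGraph D s)
               ≤ (nC D + β₁ (stateGraph D (λ _ → resolution t))) + countRes (resolution (opposite t)) s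
  count+β₁-≤ t s = begin
    a + β₁ (stateGraph D s) ≤⟨ +-monoʳ-≤ a (β₁-state-≤ t s) ⟩
    a + (W + βₜ)            ≡⟨ x∙yz≈yx∙z a W βₜ ⟩
    (W + a) + βₜ            ≡⟨ cong (λ m → m + βₜ) (totalCost+count t s) ⟩
    (nC D + b) + βₜ         ≡⟨ xy∙z≈xz∙y (nC D) b βₜ ⟩
    (nC D + βₜ) + b         ∎
    where
    open ≤-Reasoning
    a = countRes (resolution t) s
    b = countRes (resolution (opposite t)) s
    W = totalCost t s
    βₜ = β₁ (stateGraph D (λ _ → resolution t))

  ExponentsIn-state : ∀ s → ExponentsIn (- + (nC D + β₁ (stateGraph D (S_B D))))
                                        (+ (nC D + β₁ (stateGraph D (S_A D))))
                                        (monoA (+ countRes resA s ℤ.- + countRes resB s) ⊗ H (stateGraph D s))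
  ExponentsIn-state s =
    ExponentsIn-weaken (-C≤[a-b]-β a b β _ (count+β₁-≤ smoothB s)) ([a-b]+β≤C a b β _ (count+β₁-≤ smoothA s))
      (ExponentsIn-⊗ (monoA (+ a ℤ.- + b)) (H (stateGraph D s))
                     ((ℤP.≤-refl , ℤP.≤-refl) ∷ []) (ExponentsIn-H (stateGraph D s)))
    where
    a = countRes resA s
    b = countRes resB s
    β = β₁ (stateGraph D s)

  ExponentsIn-R : ExponentsIn (- + (nC D + β₁ (stateGraph D (S_B D)))) (+ (nC D + β₁ (stateGraph D (S_A D)))) (R D)
  ExponentsIn-R = ExponentsIn-lsum _ (allStates (nC D)) λ {s} _ → ExponentsIn-state s

lemma5p2 : (D : Diagram) → WellFormed D →
    ((k : ℤ) → coeff (R D) k ≢ 0ℤ → k ℤ.≤ + (crossings D + β₁ (stateGraph D (S_A D))))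
    × ((k : ℤ) → coeff (R D) k ≢ 0ℤ → - (+ (crossings D + β₁ (stateGraph D (S_B D)))) ℤ.≤ k)
lemma5p2 D _ = (λ k nonzero → proj₂ (bounds k nonzero)) , (λ k nonzero → proj₁ (bounds k nonzero))
  where
  bounds : ∀ k → coeff (R D) k ≢ 0ℤ → - + (crossings D + β₁ (stateGraph D (S_B D))) ℤ.≤ k
                                       × k ℤ.≤ + (crossings D + β₁ (stateGraph D (S_A D)))
  bounds k = coeff≢0⇒∈ (R D) (Resolutions.ExponentsIn-R D)
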